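{- For each integer $k\ge 5$, the graph $H_k$ has a proper edge-coloring with no rainbow $C_4$.
   Context: For $k\ge 5$, $H_k$ is the graph with vertex set $\{v_0,v_{k-2}\}\cup\{v_{i,j}: i\in\{1,\dots,k-3\},\ j\in\{1,\dots,k\}\}$ (so $k^2-3k+2$ vertices), where second indices $j$ are taken modulo $k$. Its edges are: $v_{i,j}v_{i,j+1}$ for every $i\in\{1,\dots,k-3\}$ and $j$ (so $v_{i,1}v_{i,2}\cdots v_{i,k}$ is a $k$-cycle); $v_{i,j}v_{i+1,j}$ and $v_{i,j}v_{i+1,j-1}$ for every $i\in\{1,\dots,k-4\}$ and $j$; $v_0v_{1,j}$ for every $j$; and $v_{k-2}v_{k-3,j}$ for every $j$. (This is a $5$-connected planar triangulation.) A proper edge-coloring assigns colors to edges so that edges sharing an endpoint get different colors; a subgraph is rainbow if all its edges have distinct colors; $C_4$ is the cycle on four vertices. -}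

module Defs where

open import Data.Nat using (ℕ; zero; suc; _∸_; _≤_)
open import Data.Fin using (Fin; toℕ)
open import Data.Product using (_×_; Σ; ∃-syntax)
open import Data.Sum using (_⊎_)
open import Relation.Binary.PropositionalEquality using (_≡_; _≢_)
open import Relation.Nullary using (¬_)

-- Vertices of H_k.
--   v0            : the vertex v_0
--   vtop          : the vertex v_{k-2}
--   vmid i j      : the vertex v_{toℕ i + 1 , toℕ j + 1}
--                   (i ranges over 1..k-3, j over 1..k)
data V (k : ℕ) : Set where
  v0   : V k
  vtop : V k
  vmid : Fin (k ∸ 3) → Fin k → V k

NextMod : (k : ℕ) → Fin k → Fin k → Set
NextMod k a b = (toℕ b ≡ suc (toℕ a)) ⊎ ((suc (toℕ a) ≡ k) × (toℕ b ≡ 0))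

-- Directed generating edges of H_k (each undirected edge listed once).
data E (k : ℕ) : V k → V k → Set where
  ring  : ∀ {i j j'} → NextMod k j j' → E k (vmid i j) (vmid i j')
  rung₁ : ∀ {i i' j} → toℕ i' ≡ suc (toℕ i) → E k (vmid i j) (vmid i' j)
  rung₂ : ∀ {i i' j j'} → toℕ i' ≡ suc (toℕ i) → NextMod k j' j →
          E k (vmid i j) (vmid i' j')
  bot   : ∀ {i j} → toℕ i ≡ 0 → E k v0 (vmid i j)
  top   : ∀ {i j} → suc (toℕ i) ≡ k ∸ 3 → E k vtop (vmid i j)

Adj : (k : ℕ) → V k → V k → Set
Adj k u v = E k u v ⊎ E k v u

-- An edge-colouring, given as a colour for each pair of vertices,
-- of which only the values on edges matter.
Colouring : ℕ → Set
Colouring k = V k → V k → ℕ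

Symmetric : (k : ℕ) → Colouring k → Set
Symmetric k c = ∀ {u v} → Adj k u v → c u v ≡ c v u

Proper : (k : ℕ) → Colouring k → Set
Proper k c = ∀ {u v w} → Adj k u v → Adj k u w → v ≢ w → c u v ≢ c u w

RainbowC4 : (k : ℕ) → Colouring k → Set
RainbowC4 k col = ∃[ a ] ∃[ b ] ∃[ c ] ∃[ d ]
  ( (a ≢ b) × (a ≢ c) × (a ≢ d) × (b ≢ c) × (b ≢ d) × (c ≢ d)
  × Adj k a b × Adj k b c × Adj k c d × Adj k d a
  × (col a b ≢ col b c) × (col a b ≢ col c d) × (col a b ≢ col d a)
  × (col b c ≢ col c d) × (col b c ≢ col d a) × (col c d ≢ col d a) )

-- Read v_{i,j} as the point (i , j) of the cylinder ℕ × ℤ/k (0-based, as in Defs). Its edges run along three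
-- axes: ring edges (i,j)(i,j+1), vertical rungs (i,j)(i+1,j) and slanted rungs (i,j)(i+1,j-1); the edges at
-- v_0 and v_{k-2} behave like slanted rungs leaving the bottom and the top row. Colour the ring edge
-- (i,j)(i,j+1) by i+j+3 and the slanted rung (i,j)(i+1,j-1) by j (both mod k), and the vertical rung between
-- rows i and i+1 by k+i+1. Each colour class is then invariant under translation along the next axis of the
-- cycle ring → slanted → vertical → ring. A 4-cycle inside the lattice is a rhombus spanned by two
-- non-parallel directions, and of two distinct axes one is the translation axis of the other, so one pair of
-- opposite sides is monochromatic. A 4-cycle through v_0 or v_{k-2} is a ring path of length two or a pair of
-- border triangles, where the offset 3 and the k-3 rows make opposite colours agree. Properness: the colours at
-- a vertex are j, j+1, i+j+2, i+j+3 (mod k) and two values ≥ k, distinct since i+3 < k.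

module Submission where

open import Defs
open import Data.Bool using (Bool; true; false; not; if_then_else_)
open import Data.Bool.Properties using () renaming (_≟_ to _≟ᵇ_)
open import Data.Empty using (⊥-elim)
open import Data.Unit using (⊤; tt)
open import Data.Fin using (Fin; toℕ)
open import Data.Fin.Properties using (toℕ-injective; toℕ<n; toℕ-fromℕ<) renaming (_≟_ to _≟ᶠ_)
open import Data.List using (List; []; _∷_)
open import Data.List.Membership.Propositional using (_∈_; lose)
open import Data.List.Relation.Unary.All as All using (all?)
open import Data.List.Relation.Unary.Any using (here; there; any?; satisfied)
open import Data.Nat using (ℕ; zero; suc; pred; _+_; _∸_; _≤_; _<_; z≤n; s≤s; NonZero)
open import Data.Nat.DivMod
  using (_%_; _mod_; m%n<n; m<n⇒m%n≡m; [m+n]%n≡m%n; %-distribˡ-+; m%n%n≡m%n; n%n≡0; m≤n⇒[n∸m]%m≡n%m)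
open import Data.Nat.Properties
open import Algebra.Properties.CommutativeSemigroup +-commutativeSemigroup using (x∙yz≈y∙xz)
open import Data.Product using (Σ; ∃; _×_; _,_; proj₁; proj₂; map)
open import Data.Product.Properties using (≡-dec; ×-≡,≡→≡)
open import Data.Sum using (_⊎_; inj₁; inj₂; swap)
open import Function using (_∘_)
open import Relation.Binary.PropositionalEquality
open import Relation.Nullary using (¬_; Dec; yes; no; does)
open import Relation.Nullary.Decidable using (map′; from-yes; _×-dec_; _→-dec_; ¬?; dec-true; dec-false)
open import Relation.Unary using (Decidable)

module CyclicShift (k : ℕ) .{{_ : NonZero k}} where

  next : Fin k → Fin k
  next j = suc (toℕ j) mod k

  shift : ℕ → Fin k → Fin k
  shift zero    j = j
  shift (suc a) j = shift a (next j)

  toℕ-next : ∀ j → toℕ (next j) ≡ suc (toℕ j) % k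
  toℕ-next j = toℕ-fromℕ< (m%n<n (suc (toℕ j)) k)

  toℕ-shift : ∀ a j → toℕ (shift a j) ≡ (a + toℕ j) % k
  toℕ-shift zero    j = sym (m<n⇒m%n≡m (toℕ<n j))
  toℕ-shift (suc a) j = begin
    toℕ (shift a (next j))               ≡⟨ toℕ-shift a (next j) ⟩
    (a + toℕ (next j)) % k               ≡⟨ cong (λ x → (a + x) % k) (toℕ-next j) ⟩
    (a + suc (toℕ j) % k) % k            ≡⟨ %-distribˡ-+ a _ k ⟩
    (a % k + suc (toℕ j) % k % k) % k    ≡⟨ cong (λ x → (a % k + x) % k) (m%n%n≡m%n (suc (toℕ j)) k) ⟩
    (a % k + suc (toℕ j) % k) % k        ≡⟨ sym (%-distribˡ-+ a (suc (toℕ j)) k) ⟩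
    (a + suc (toℕ j)) % k                ≡⟨ cong (_% k) (+-suc a (toℕ j)) ⟩
    (suc a + toℕ j) % k                  ∎
    where open ≡-Reasoning

  shift-+ : ∀ a b j → shift (a + b) j ≡ shift b (shift a j)
  shift-+ zero    b j = refl
  shift-+ (suc a) b j = shift-+ a b (next j)

  shift-comm : ∀ a b j → shift a (shift b j) ≡ shift b (shift a j)
  shift-comm a b j = trans (sym (shift-+ b a j)) (trans (cong (λ c → shift c j) (+-comm b a)) (shift-+ a b j))

  shift-k : ∀ j → shift k j ≡ j
  shift-k j = toℕ-injective (begin
    toℕ (shift k j)    ≡⟨ toℕ-shift k j ⟩
    (k + toℕ j) % k    ≡⟨ cong (_% k) (+-comm k (toℕ j)) ⟩
    (toℕ j + k) % k    ≡⟨ [m+n]%n≡m%n (toℕ j) k ⟩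
    toℕ j % k          ≡⟨ m<n⇒m%n≡m (toℕ<n j) ⟩
    toℕ j              ∎)
    where open ≡-Reasoning

  shift-wraps : ∀ {a b} → a + b ≡ k → ∀ j → shift b (shift a j) ≡ j
  shift-wraps {a} {b} a+b≡k j = trans (sym (shift-+ a b j)) (trans (cong (λ c → shift c j) a+b≡k) (shift-k j))

  next-injective : ∀ {i j} → next i ≡ next j → i ≡ j
  next-injective {i} {j} e = begin
    i                     ≡⟨ sym (shift-k i) ⟩
    shift k i             ≡⟨ cong (λ a → shift a i) (sym (suc-pred k)) ⟩
    shift (pred k) (next i) ≡⟨ cong (shift (pred k)) e ⟩
    shift (pred k) (next j) ≡⟨ cong (λ a → shift a j) (suc-pred k) ⟩
    shift k j             ≡⟨ shift-k j ⟩
    j                     ∎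
    where open ≡-Reasoning

  shift-injective : ∀ a {i j} → shift a i ≡ shift a j → i ≡ j
  shift-injective zero    e = e
  shift-injective (suc a) e = next-injective (shift-injective a e)

  shift-fixed : ∀ {w} j → w < k → shift w j ≡ j → w ≡ 0
  shift-fixed {w} j w<k e with w + toℕ j <? k
  ... | yes small = +-cancelʳ-≡ (toℕ j) w 0 (trans (sym (m<n⇒m%n≡m small)) wrapped)
    where
    wrapped : (w + toℕ j) % k ≡ toℕ j
    wrapped = trans (sym (toℕ-shift w j)) (cong toℕ e)
  ... | no large = ⊥-elim (<⇒≢ w<k (+-cancelʳ-≡ (toℕ j) w k w+j≡j+k))
    where
    k≤w+j = ≮⇒≥ large
    r = w + toℕ j ∸ k
    r+k≡w+j : r + k ≡ w + toℕ j
    r+k≡w+j = m∸n+n≡m k≤w+j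
    r<k : r < k
    r<k = +-cancelʳ-< k r k (subst (_< k + k) (sym r+k≡w+j) (+-mono-< w<k (toℕ<n j)))
    r≡j : r ≡ toℕ j
    r≡j = begin
      r                   ≡⟨ sym (m<n⇒m%n≡m r<k) ⟩
      r % k               ≡⟨ m≤n⇒[n∸m]%m≡n%m k≤w+j ⟩
      (w + toℕ j) % k     ≡⟨ sym (toℕ-shift w j) ⟩
      toℕ (shift w j)     ≡⟨ cong toℕ e ⟩
      toℕ j               ∎
      where open ≡-Reasoning
    w+j≡j+k : w + toℕ j ≡ k + toℕ j
    w+j≡j+k = trans (sym r+k≡w+j) (trans (cong (_+ k) r≡j) (+-comm (toℕ j) k))

  shift-injective-≤ : ∀ {a b} j → a ≤ b → b < k → shift a j ≡ shift b j → a ≡ b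
  shift-injective-≤ {a} j a≤b b<k e with m≤n⇒∃[o]m+o≡n a≤b
  ... | w , refl = sym (trans (cong (a +_) w≡0) (+-identityʳ a))
    where
    w≡0 : w ≡ 0
    w≡0 = shift-fixed (shift a j) (≤-<-trans (m≤n+m w a) b<k) (sym (trans e (shift-+ a w j)))

  shift-injectiveˡ : ∀ {a b} j → a < k → b < k → shift a j ≡ shift b j → a ≡ b
  shift-injectiveˡ j a<k b<k e with ≤-total _ _
  ... | inj₁ a≤b = shift-injective-≤ j a≤b b<k e
  ... | inj₂ b≤a = sym (shift-injective-≤ j b≤a a<k (sym e))

  NextMod⇒next : ∀ {i j} → NextMod k i j → next i ≡ j
  NextMod⇒next {i} {j} (inj₁ j≡1+i) = toℕ-injective (begin
    toℕ (next i)        ≡⟨ toℕ-next i ⟩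
    suc (toℕ i) % k     ≡⟨ cong (_% k) (sym j≡1+i) ⟩
    toℕ j % k           ≡⟨ m<n⇒m%n≡m (toℕ<n j) ⟩
    toℕ j               ∎)
    where open ≡-Reasoning
  NextMod⇒next {i} {j} (inj₂ (1+i≡k , j≡0)) = toℕ-injective (begin
    toℕ (next i)        ≡⟨ toℕ-next i ⟩
    suc (toℕ i) % k     ≡⟨ cong (_% k) 1+i≡k ⟩
    k % k               ≡⟨ n%n≡0 k ⟩
    0                   ≡⟨ sym j≡0 ⟩
    toℕ j               ∎)
    where open ≡-Reasoning

  shift-trans : ∀ a b c d {j j′ j″} → shift a j ≡ shift b j′ → shift c j′ ≡ shift d j″ →
                shift (a + c) j ≡ shift (b + d) j″
  shift-trans a b c d {j} {j′} {j″} e₁ e₂ = begin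
    shift (a + c) j          ≡⟨ shift-+ a c j ⟩
    shift c (shift a j)      ≡⟨ cong (shift c) e₁ ⟩
    shift c (shift b j′)     ≡⟨ shift-comm c b j′ ⟩
    shift b (shift c j′)     ≡⟨ cong (shift b) e₂ ⟩
    shift b (shift d j″)     ≡⟨ sym (shift-+ d b j″) ⟩
    shift (d + b) j″         ≡⟨ cong (λ x → shift x j″) (+-comm d b) ⟩
    shift (b + d) j″         ∎
    where open ≡-Reasoning

difference-trans : ∀ a b c d {x y z} → a + x ≡ b + y → c + y ≡ d + z → (a + c) + x ≡ (b + d) + z
difference-trans a b c d {x} {y} {z} e₁ e₂ = begin
  (a + c) + x      ≡⟨ +-assoc a c x ⟩
  a + (c + x)      ≡⟨ x∙yz≈y∙xz a c x ⟩
  c + (a + x)      ≡⟨ cong (c +_) e₁ ⟩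
  c + (b + y)      ≡⟨ x∙yz≈y∙xz c b y ⟩
  b + (c + y)      ≡⟨ cong (b +_) e₂ ⟩
  b + (d + z)      ≡⟨ sym (+-assoc b d z) ⟩
  (b + d) + z      ∎
  where open ≡-Reasoning

-- A formal difference (up − down , right − left), kept in ℕ so that no truncated subtraction occurs.
record Displacement : Set where
  constructor displacement
  field
    up down right left : ℕ

open Displacement

infixl 6 _⊕_
infix 4 _≈_

_⊕_ : Displacement → Displacement → Displacement
s ⊕ t = displacement (up s + up t) (down s + down t) (right s + right t) (left s + left t)

reverse : Displacement → Displacement
reverse s = displacement (down s) (up s) (left s) (right s)

Null : Displacement → Set
Null s = (up s ≡ down s) × (right s ≡ left s)

null? : ∀ s → Dec (Null s)
null? s = (up s ≟ down s) ×-dec (right s ≟ left s)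

_≈_ : Displacement → Displacement → Set
s ≈ t = Null (s ⊕ reverse t)

Small : Displacement → Set
Small s = right s ≤ 4 × left s ≤ 4

small? : ∀ s → Dec (Small s)
small? s = (right s ≤? 4) ×-dec (left s ≤? 4)

module Cylinder (k : ℕ) .{{_ : NonZero k}} where
  open CyclicShift k

  Point : Set
  Point = ℕ × Fin k

  -- Rows do not wrap around, columns do; Moves s p q says q = p + s.
  Moves : Displacement → Point → Point → Set
  Moves s p q = (up s + proj₁ p ≡ down s + proj₁ q) × (shift (right s) (proj₂ p) ≡ shift (left s) (proj₂ q))

  moves? : ∀ s p q → Dec (Moves s p q)
  moves? s p q = (up s + proj₁ p ≟ down s + proj₁ q) ×-dec (shift (right s) (proj₂ p) ≟ᶠ shift (left s) (proj₂ q))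

  Moves-⊕ : ∀ s t {p q r} → Moves s p q → Moves t q r → Moves (s ⊕ t) p r
  Moves-⊕ s t (e₁ , f₁) (e₂ , f₂) =
    difference-trans (up s) (down s) (up t) (down t) e₁ e₂ ,
    shift-trans (right s) (left s) (right t) (left t) f₁ f₂

  Moves-reverse : ∀ s {p q} → Moves s p q → Moves (reverse s) q p
  Moves-reverse s (e , f) = sym e , sym f

  Moves-functional : ∀ s {p q r} → Moves s p q → Moves s p r → q ≡ r
  Moves-functional s (e₁ , f₁) (e₂ , f₂) =
    ×-≡,≡→≡ (+-cancelˡ-≡ (down s) _ _ (trans (sym e₁) e₂) , shift-injective (left s) (trans (sym f₁) f₂))

  Moves-injective : ∀ s {p q r} → Moves s p r → Moves s q r → p ≡ q
  Moves-injective s m₁ m₂ = Moves-functional (reverse s) (Moves-reverse s m₁) (Moves-reverse s m₂)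

  Moves-rising : ∀ s {p q} → Moves s p q → proj₁ p ≤ proj₁ q → down s ≤ up s
  Moves-rising s {i , _} {i′ , _} (e , _) i≤i′ =
    +-cancelʳ-≤ i (down s) (up s) (≤-trans (+-monoʳ-≤ (down s) i≤i′) (≤-reflexive (sym e)))

  Moves-falling : ∀ s {p q} → Moves s p q → proj₁ q ≤ proj₁ p → up s ≤ down s
  Moves-falling s m = Moves-rising (reverse s) (Moves-reverse s m)

  Moves-null : ∀ s {p} → right s < k → left s < k → Moves s p p → Null s
  Moves-null s {_ , j} r<k l<k (e , f) = +-cancelʳ-≡ _ _ _ e , shift-injectiveˡ j r<k l<k f

data Axis : Set where
  horizontal vertical slanted : Axis

_≟ᴬ_ : (a b : Axis) → Dec (a ≡ b)
horizontal ≟ᴬ horizontal = yes refl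
horizontal ≟ᴬ vertical   = no λ ()
horizontal ≟ᴬ slanted    = no λ ()
vertical   ≟ᴬ horizontal = no λ ()
vertical   ≟ᴬ vertical   = yes refl
vertical   ≟ᴬ slanted    = no λ ()
slanted    ≟ᴬ horizontal = no λ ()
slanted    ≟ᴬ vertical   = no λ ()
slanted    ≟ᴬ slanted    = yes refl

transversal : Axis → Axis
transversal horizontal = slanted
transversal vertical   = horizontal
transversal slanted    = vertical

transversal-dichotomy : ∀ {a b} → a ≢ b → b ≡ transversal a ⊎ a ≡ transversal b
transversal-dichotomy {horizontal} {horizontal} a≢b = ⊥-elim (a≢b refl)
transversal-dichotomy {horizontal} {vertical}   _   = inj₂ refl
transversal-dichotomy {horizontal} {slanted}    _   = inj₁ refl
transversal-dichotomy {vertical}   {horizontal} _   = inj₁ refl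
transversal-dichotomy {vertical}   {vertical}   a≢b = ⊥-elim (a≢b refl)
transversal-dichotomy {vertical}   {slanted}    _   = inj₂ refl
transversal-dichotomy {slanted}    {horizontal} _   = inj₂ refl
transversal-dichotomy {slanted}    {vertical}   _   = inj₁ refl
transversal-dichotomy {slanted}    {slanted}    a≢b = ⊥-elim (a≢b refl)

-- true orients an axis towards increasing j, or towards increasing i for vertical rungs.
Direction : Set
Direction = Axis × Bool

pattern R⁺ = horizontal , true
pattern R⁻ = horizontal , false
pattern U  = vertical , true
pattern D  = vertical , false
pattern DR = slanted , true
pattern UL = slanted , false

neg : Direction → Direction
neg (a , s) = a , not s

_≟ᴰ_ : (d d′ : Direction) → Dec (d ≡ d′)
_≟ᴰ_ = ≡-dec _≟ᴬ_ _≟ᵇ_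

same-axis : ∀ {x y} → proj₁ x ≡ proj₁ y → y ≡ x ⊎ y ≡ neg x
same-axis {_ , true}  {_ , true}  refl = inj₁ refl
same-axis {_ , true}  {_ , false} refl = inj₂ refl
same-axis {_ , false} {_ , true}  refl = inj₂ refl
same-axis {_ , false} {_ , false} refl = inj₁ refl

axes-differ : ∀ {x y} → x ≢ y → y ≢ neg x → proj₁ x ≢ proj₁ y
axes-differ x≢y y≢-x e with same-axis e
... | inj₁ y≡x  = x≢y (sym y≡x)
... | inj₂ y≡-x = y≢-x y≡-x

δ : Direction → Displacement
δ R⁺ = displacement 0 0 1 0
δ R⁻ = displacement 0 0 0 1
δ U  = displacement 1 0 0 0
δ D  = displacement 0 1 0 0
δ DR = displacement 0 1 1 0
δ UL = displacement 1 0 0 1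

δ-neg : ∀ d → δ (neg d) ≡ reverse (δ d)
δ-neg R⁺ = refl
δ-neg R⁻ = refl
δ-neg U  = refl
δ-neg D  = refl
δ-neg DR = refl
δ-neg UL = refl

directions : List Direction
directions = R⁺ ∷ R⁻ ∷ U ∷ D ∷ DR ∷ UL ∷ []

∈-directions : ∀ d → d ∈ directions
∈-directions R⁺ = here refl
∈-directions R⁻ = there (here refl)
∈-directions U  = there (there (here refl))
∈-directions D  = there (there (there (here refl)))
∈-directions DR = there (there (there (there (here refl))))
∈-directions UL = there (there (there (there (there (here refl)))))

∀? : {P : Direction → Set} → Decidable P → Dec (∀ d → P d)
∀? P? = map′ (λ all d → All.lookup all (∈-directions d)) (λ f → All.tabulate λ {d} _ → f d) (all? P? directions)

∃? : {P : Direction → Set} → Decidable P → Dec (∃ P)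
∃? P? = map′ satisfied (λ (d , p) → lose (∈-directions d) p) (any? P? directions)

open import Data.List.Membership.DecPropositional (≡-dec _≟ᴰ_ _≟ᴰ_) using (_∈?_)

bottom-corners : List (Direction × Direction)
bottom-corners = (R⁺ , R⁻) ∷ (R⁻ , R⁺) ∷ (U , UL) ∷ (UL , U) ∷ []

top-corners : List (Direction × Direction)
top-corners = (R⁺ , R⁻) ∷ (R⁻ , R⁺) ∷ (D , DR) ∷ (DR , D) ∷ []

-- Checked by evaluating a decision procedure over all cases; opaque, so that a later `with` never unfolds them.
opaque
  δ-injective : ∀ d d′ → δ d ≈ δ d′ → d ≡ d′
  δ-injective = from-yes (∀? λ d → ∀? λ d′ → null? (δ d ⊕ reverse (δ d′)) →-dec d ≟ᴰ d′)

  small-pair : ∀ d d′ → Small (δ d ⊕ reverse (δ d′))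
  small-pair = from-yes (∀? λ d → ∀? λ d′ → small? (δ d ⊕ reverse (δ d′)))

  small-square : ∀ x y x′ y′ → Small ((δ x ⊕ δ y) ⊕ reverse (δ x′ ⊕ δ y′))
  small-square = from-yes (∀? λ x → ∀? λ y → ∀? λ x′ → ∀? λ y′ →
    small? ((δ x ⊕ δ y) ⊕ reverse (δ x′ ⊕ δ y′)))

  δ-sum-decomposition : ∀ x y x′ y′ → x ≢ x′ → y ≢ neg x → δ x ⊕ δ y ≈ δ x′ ⊕ δ y′ → x′ ≡ y × y′ ≡ x
  δ-sum-decomposition = from-yes (∀? λ x → ∀? λ y → ∀? λ x′ → ∀? λ y′ →
    ¬? (x ≟ᴰ x′) →-dec ¬? (y ≟ᴰ neg x) →-dec null? ((δ x ⊕ δ y) ⊕ reverse (δ x′ ⊕ δ y′)) →-dec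
    (x′ ≟ᴰ y) ×-dec (y′ ≟ᴰ x))

  bottom-corner-directions : ∀ d₁ d₂ → down (δ d₁) ≤ up (δ d₁) → down (δ d₂) ≤ up (δ d₂) → d₁ ≢ d₂ →
    up (δ d₁ ⊕ reverse (δ d₂)) ≡ down (δ d₁ ⊕ reverse (δ d₂)) → (d₁ , d₂) ∈ bottom-corners
  bottom-corner-directions = from-yes (∀? λ d₁ → ∀? λ d₂ →
    (down (δ d₁) ≤? up (δ d₁)) →-dec (down (δ d₂) ≤? up (δ d₂)) →-dec ¬? (d₁ ≟ᴰ d₂) →-dec
    (up (δ d₁ ⊕ reverse (δ d₂)) ≟ down (δ d₁ ⊕ reverse (δ d₂))) →-dec ((d₁ , d₂) ∈? bottom-corners))

  top-corner-directions : ∀ d₁ d₂ → up (δ d₁) ≤ down (δ d₁) → up (δ d₂) ≤ down (δ d₂) → d₁ ≢ d₂ →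
    up (δ d₁ ⊕ reverse (δ d₂)) ≡ down (δ d₁ ⊕ reverse (δ d₂)) → (d₁ , d₂) ∈ top-corners
  top-corner-directions = from-yes (∀? λ d₁ → ∀? λ d₂ →
    (up (δ d₁) ≤? down (δ d₁)) →-dec (up (δ d₂) ≤? down (δ d₂)) →-dec ¬? (d₁ ≟ᴰ d₂) →-dec
    (up (δ d₁ ⊕ reverse (δ d₂)) ≟ down (δ d₁ ⊕ reverse (δ d₂))) →-dec ((d₁ , d₂) ∈? top-corners))

module TriangularLattice (k : ℕ) .{{_ : NonZero k}} (k>4 : 4 < k) where
  open CyclicShift k
  open Cylinder k

  record Step (d : Direction) (p q : Point) : Set where
    constructor step
    field moves : Moves (δ d) p q

  Step-rows : ∀ {d p q} → Step d p q → up (δ d) + proj₁ p ≡ down (δ d) + proj₁ q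
  Step-rows = proj₁ ∘ Step.moves

  step? : ∀ d p q → Dec (Step d p q)
  step? d p q = map′ step Step.moves (moves? (δ d) p q)

  Step-neg : ∀ {d p q} → Step d p q → Step (neg d) q p
  Step-neg {d} (step m) = step (subst (λ s → Moves s _ _) (sym (δ-neg d)) (Moves-reverse (δ d) m))

  Step-functional : ∀ {d p q r} → Step d p q → Step d p r → q ≡ r
  Step-functional {d} (step m) (step m′) = Moves-functional (δ d) m m′

  Step-injective : ∀ {d p q r} → Step d p r → Step d q r → p ≡ q
  Step-injective {d} (step m) (step m′) = Moves-injective (δ d) m m′

  Moves-≈ : ∀ s t {p q} → Small (s ⊕ reverse t) → Moves s p q → Moves t p q → s ≈ t
  Moves-≈ s t (r≤4 , l≤4) m m′ =
    Moves-null (s ⊕ reverse t) (≤-<-trans r≤4 k>4) (≤-<-trans l≤4 k>4) (Moves-⊕ s (reverse t) m (Moves-reverse t m′))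

  direction-unique : ∀ {d d′ p q} → Step d p q → Step d′ p q → d ≡ d′
  direction-unique {d} {d′} (step m) (step m′) = δ-injective d d′ (Moves-≈ (δ d) (δ d′) (small-pair d d′) m m′)

  common-neighbour : ∀ {d₁ d₂ p₁ p₂ q} → p₁ ≢ p₂ → Step d₁ p₁ q → Step d₂ p₂ q →
    d₁ ≢ d₂ × Moves (δ d₁ ⊕ reverse (δ d₂)) p₁ p₂
  common-neighbour {d₁} {d₂} p₁≢p₂ s₁@(step m₁) s₂@(step m₂) =
    (λ { refl → p₁≢p₂ (Step-injective s₁ s₂) }) , Moves-⊕ (δ d₁) (reverse (δ d₂)) m₁ (Moves-reverse (δ d₂) m₂)

  Step-distinct : ∀ {x x′ a b d} → b ≢ d → Step x a b → Step x′ a d → x ≢ x′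
  Step-distinct b≢d sx sx′ refl = b≢d (Step-functional sx sx′)

  Step-no-backtrack : ∀ {x y a b c} → a ≢ c → Step x a b → Step y b c → y ≢ neg x
  Step-no-backtrack a≢c sx sy refl = a≢c (Step-functional (Step-neg sx) sy)

  data Rhombus : Direction → Direction → Direction → Direction → Set where
    rhombus-sides : ∀ {x y} → x ≢ y → y ≢ neg x → Rhombus x y y x

  square-is-rhombus : ∀ {x y x′ y′ a b c d} → a ≢ c → b ≢ d →
    Step x a b → Step y b c → Step x′ a d → Step y′ d c → Rhombus x y x′ y′
  square-is-rhombus {x} {y} {x′} {y′} a≢c b≢d sx@(step m₁) sy@(step m₂) sx′@(step m₃) sy′@(step m₄)
    with δ-sum-decomposition x y x′ y′ (Step-distinct b≢d sx sx′) (Step-no-backtrack a≢c sx sy)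
           (Moves-≈ (δ x ⊕ δ y) (δ x′ ⊕ δ y′) (small-square x y x′ y′)
             (Moves-⊕ (δ x) (δ y) m₁ m₂) (Moves-⊕ (δ x′) (δ y′) m₃ m₄))
  ... | refl , refl = rhombus-sides (Step-distinct b≢d sx sx′) (Step-no-backtrack a≢c sx sy)

  data Hue : Set where
    cyclic : ℕ → Hue
    layer  : ℕ → Hue

  paint : Hue → Fin k → ℕ
  paint (cyclic o) j = toℕ (shift o j)
  paint (layer ℓ)  _ = k + ℓ

  hue : Direction → ℕ → Hue
  hue R⁺ i = cyclic (3 + i)
  hue R⁻ i = cyclic (2 + i)
  hue U  i = layer (suc i)
  hue D  i = layer i
  hue DR _ = cyclic 1
  hue UL _ = cyclic 0

  edgeColour : Direction → Point → ℕ
  edgeColour d (i , j) = paint (hue d i) j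

  edgeColour-neg : ∀ {d p q} → Step d p q → edgeColour d p ≡ edgeColour (neg d) q
  edgeColour-neg {R⁺} {_ , _} {_ , _} (step (refl , refl)) = refl
  edgeColour-neg {R⁻} {_ , _} {_ , _} (step (refl , refl)) = refl
  edgeColour-neg {U}  {_ , _} {_ , _} (step (refl , refl)) = refl
  edgeColour-neg {D}  {_ , _} {_ , _} (step (refl , refl)) = refl
  edgeColour-neg {DR} {_ , _} {_ , _} (step (refl , refl)) = refl
  edgeColour-neg {UL} {_ , _} {_ , _} (step (refl , refl)) = refl

  edgeColour-invariant : ∀ x t {p q} → Step (transversal (proj₁ x) , t) p q → edgeColour x p ≡ edgeColour x q
  edgeColour-invariant R⁺ true  {_ , _} {_ , _} (step (refl , refl)) = refl
  edgeColour-invariant R⁺ false {_ , _} {_ , _} (step (refl , refl)) = refl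
  edgeColour-invariant R⁻ true  {_ , _} {_ , _} (step (refl , refl)) = refl
  edgeColour-invariant R⁻ false {_ , _} {_ , _} (step (refl , refl)) = refl
  edgeColour-invariant U  true  {_ , _} {_ , _} (step (refl , refl)) = refl
  edgeColour-invariant U  false {_ , _} {_ , _} (step (refl , refl)) = refl
  edgeColour-invariant D  true  {_ , _} {_ , _} (step (refl , refl)) = refl
  edgeColour-invariant D  false {_ , _} {_ , _} (step (refl , refl)) = refl
  edgeColour-invariant DR true  {_ , _} {_ , _} (step (refl , refl)) = refl
  edgeColour-invariant DR false {_ , _} {_ , _} (step (refl , refl)) = refl
  edgeColour-invariant UL true  {_ , _} {_ , _} (step (refl , refl)) = refl
  edgeColour-invariant UL false {_ , _} {_ , _} (step (refl , refl)) = refl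

  rhombus-colours : ∀ {x y a b d} → proj₁ x ≢ proj₁ y → Step x a b → Step y a d →
    edgeColour x a ≡ edgeColour x d ⊎ edgeColour y b ≡ edgeColour y a
  rhombus-colours {a₁ , s} {a₂ , t} a₁≢a₂ sx sy with transversal-dichotomy a₁≢a₂
  ... | inj₁ refl = inj₁ (edgeColour-invariant (a₁ , s) t sy)
  ... | inj₂ refl = inj₂ (sym (edgeColour-invariant (a₂ , t) s sx))

  square-colours : ∀ {x y x′ y′ a b c d} → a ≢ c → b ≢ d →
    Step x a b → Step y b c → Step x′ a d → Step y′ d c →
    edgeColour x a ≡ edgeColour y′ d ⊎ edgeColour y b ≡ edgeColour x′ a
  square-colours a≢c b≢d sx sy sx′ sy′ with square-is-rhombus a≢c b≢d sx sy sx′ sy′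
  ... | rhombus-sides x≢y y≢-x = rhombus-colours (axes-differ x≢y y≢-x) sx sx′

  InRange : Hue → Set
  InRange (cyclic o) = o < k
  InRange (layer _)  = ⊤

  hue-in-range : ∀ d {i} → 3 + i < k → InRange (hue d i)
  hue-in-range R⁺     row<k = row<k
  hue-in-range R⁻ {i} row<k = <-trans (n<1+n (2 + i)) row<k
  hue-in-range U      _     = tt
  hue-in-range D      _     = tt
  hue-in-range DR {i} row<k = ≤-<-trans (m≤m+n 1 (2 + i)) row<k
  hue-in-range UL     row<k = ≤-<-trans z≤n row<k

  cyclic≢layer : ∀ o ℓ j → paint (cyclic o) j ≢ paint (layer ℓ) j
  cyclic≢layer o ℓ j = <⇒≢ (<-≤-trans (toℕ<n (shift o j)) (m≤m+n k ℓ))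

  paint-injective : ∀ {h h′} j → InRange h → InRange h′ → paint h j ≡ paint h′ j → h ≡ h′
  paint-injective {cyclic _} {cyclic _} j o<k o′<k e = cong cyclic (shift-injectiveˡ j o<k o′<k (toℕ-injective e))
  paint-injective {cyclic o} {layer ℓ}  j _   _    e = ⊥-elim (cyclic≢layer o ℓ j e)
  paint-injective {layer ℓ}  {cyclic o} j _   _    e = ⊥-elim (cyclic≢layer o ℓ j (sym e))
  paint-injective {layer _}  {layer _}  j _   _    e = cong layer (+-cancelˡ-≡ k _ _ e)

  hue-direction : ℕ → Hue → Direction
  hue-direction i (cyclic zero)          = UL
  hue-direction i (cyclic (suc zero))    = DR
  hue-direction i (cyclic (suc (suc o))) = if does (o ≟ i) then R⁻ else R⁺
  hue-direction i (layer ℓ)              = if does (ℓ ≟ i) then D else U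

  hue-direction-hue : ∀ d i → hue-direction i (hue d i) ≡ d
  hue-direction-hue R⁺ i = cong (λ b → if b then R⁻ else R⁺) (dec-false (suc i ≟ i) 1+n≢n)
  hue-direction-hue R⁻ i = cong (λ b → if b then R⁻ else R⁺) (dec-true (i ≟ i) refl)
  hue-direction-hue U  i = cong (λ b → if b then D else U) (dec-false (suc i ≟ i) 1+n≢n)
  hue-direction-hue D  i = cong (λ b → if b then D else U) (dec-true (i ≟ i) refl)
  hue-direction-hue DR i = refl
  hue-direction-hue UL i = refl

  edgeColour-injective : ∀ {d d′ i j} → 3 + i < k → edgeColour d (i , j) ≡ edgeColour d′ (i , j) → d ≡ d′
  edgeColour-injective {d} {d′} {i} {j} row<k e = begin
    d                           ≡⟨ sym (hue-direction-hue d i) ⟩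
    hue-direction i (hue d i)   ≡⟨ cong (hue-direction i) same-hue ⟩
    hue-direction i (hue d′ i)  ≡⟨ hue-direction-hue d′ i ⟩
    d′                          ∎
    where
    open ≡-Reasoning
    same-hue = paint-injective j (hue-in-range d row<k) (hue-in-range d′ row<k) e

  latticeColour : Point → Point → ℕ
  latticeColour p q with ∃? (λ d → step? d p q)
  ... | yes (d , _) = edgeColour d p
  ... | no _        = 0

  latticeColour-Step : ∀ {d p q} → Step d p q → latticeColour p q ≡ edgeColour d p
  latticeColour-Step {d} {p} {q} s with ∃? (λ d → step? d p q)
  ... | yes (d′ , s′) = cong (λ x → edgeColour x p) (direction-unique s′ s)
  ... | no none       = ⊥-elim (none (d , s))

  latticeColour-symmetric : ∀ {d p q} → Step d p q → latticeColour p q ≡ latticeColour q p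
  latticeColour-symmetric s =
    trans (latticeColour-Step s) (trans (edgeColour-neg s) (sym (latticeColour-Step (Step-neg s))))

  bottom-colours : ∀ {d₁ d₂ j₁ j₂} → (d₁ , d₂) ∈ bottom-corners →
    shift (right (δ d₁ ⊕ reverse (δ d₂))) j₁ ≡ shift (left (δ d₁ ⊕ reverse (δ d₂))) j₂ →
    edgeColour DR (0 , j₁) ≡ edgeColour d₂ (0 , j₂) ⊎ edgeColour d₁ (0 , j₁) ≡ edgeColour DR (0 , j₂)
  bottom-colours (here refl)                         e = inj₂ (cong (toℕ ∘ next) e)
  bottom-colours (there (here refl))                 e = inj₁ (cong (toℕ ∘ next) e)
  bottom-colours (there (there (here refl)))         e = inj₁ (cong toℕ e)
  bottom-colours (there (there (there (here refl)))) e = inj₂ (cong toℕ e)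

  top-colours : ∀ {r d₁ d₂ j₁ j₂} → 4 + r ≡ k → (d₁ , d₂) ∈ top-corners →
    shift (right (δ d₁ ⊕ reverse (δ d₂))) j₁ ≡ shift (left (δ d₁ ⊕ reverse (δ d₂))) j₂ →
    edgeColour UL (r , j₁) ≡ edgeColour d₂ (r , j₂) ⊎ edgeColour d₁ (r , j₁) ≡ edgeColour UL (r , j₂)
  top-colours {r} 4+r≡k (here refl) e =
    inj₁ (cong toℕ (sym (trans (cong (shift (2 + r)) (sym e)) (shift-wraps {2} 4+r≡k _))))
  top-colours {r} 4+r≡k (there (here refl)) e =
    inj₂ (cong toℕ (trans (cong (shift (2 + r)) e) (shift-wraps {2} 4+r≡k _)))
  top-colours _ (there (there (here refl)))         e = inj₁ (cong toℕ e)
  top-colours _ (there (there (there (here refl)))) e = inj₂ (cong toℕ e)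

  bottom-corner : ∀ {d₁ d₂ i₁ i₂ j₁ j₂ q} → i₁ ≡ 0 → i₂ ≡ 0 → (i₁ , j₁) ≢ (i₂ , j₂) →
    Step d₁ (i₁ , j₁) q → Step d₂ (i₂ , j₂) q →
    edgeColour DR (i₁ , j₁) ≡ edgeColour d₂ (i₂ , j₂) ⊎ edgeColour d₁ (i₁ , j₁) ≡ edgeColour DR (i₂ , j₂)
  bottom-corner {d₁} {d₂} refl refl p₁≢p₂ s₁@(step m₁) s₂@(step m₂) =
    let d₁≢d₂ , (rows , columns) = common-neighbour p₁≢p₂ s₁ s₂ in
    bottom-colours (bottom-corner-directions d₁ d₂ (Moves-rising (δ d₁) m₁ z≤n) (Moves-rising (δ d₂) m₂ z≤n)
                     d₁≢d₂ (+-cancelʳ-≡ 0 _ _ rows))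
                   columns

  top-corner : ∀ {r d₁ d₂ i₁ i₂ j₁ j₂ q} → 4 + r ≡ k → proj₁ q ≤ r → i₁ ≡ r → i₂ ≡ r → (i₁ , j₁) ≢ (i₂ , j₂) →
    Step d₁ (i₁ , j₁) q → Step d₂ (i₂ , j₂) q →
    edgeColour UL (i₁ , j₁) ≡ edgeColour d₂ (i₂ , j₂) ⊎ edgeColour d₁ (i₁ , j₁) ≡ edgeColour UL (i₂ , j₂)
  top-corner {r} {d₁} {d₂} 4+r≡k q≤r refl refl p₁≢p₂ s₁@(step m₁) s₂@(step m₂) =
    let d₁≢d₂ , (rows , columns) = common-neighbour p₁≢p₂ s₁ s₂ in
    top-colours 4+r≡k (top-corner-directions d₁ d₂ (Moves-falling (δ d₁) m₁ q≤r) (Moves-falling (δ d₂) m₂ q≤r)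
                         d₁≢d₂ (+-cancelʳ-≡ r _ _ rows))
                columns

module Hk (n : ℕ) where
  k : ℕ
  k = 5 + n

  open CyclicShift k
  open Cylinder k
  open TriangularLattice k (m≤m+n 5 n)

  Row : Set
  Row = Fin (k ∸ 3)

  row-bound : ∀ (i : Row) → 3 + toℕ i < k
  row-bound i = s≤s (s≤s (s≤s (toℕ<n i)))

  point : Row → Fin k → Point
  point i j = toℕ i , j

  point-injective : ∀ {i i′ j j′} → point i j ≡ point i′ j′ → vmid i j ≡ vmid i′ j′
  point-injective e = cong₂ vmid (toℕ-injective (cong proj₁ e)) (cong proj₂ e)

  apart : ∀ {i i′ j j′} → vmid i j ≢ vmid i′ j′ → point i j ≢ point i′ j′
  apart ne = ne ∘ point-injective

  -- The neighbour of vmid i j in direction d; v0 and vtop end the slanted rungs leaving the border rows.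
  Target : Direction → Row → Fin k → V k → Set
  Target d i j v0           = d ≡ DR × toℕ i ≡ 0
  Target d i j vtop         = d ≡ UL × suc (toℕ i) ≡ k ∸ 3
  Target d i j (vmid i′ j′) = Step d (point i j) (point i′ j′)

  edge-step : ∀ {i j i′ j′} → E k (vmid i j) (vmid i′ j′) → ∃ λ d → Step d (point i j) (point i′ j′)
  edge-step (ring j→j′)       = R⁺ , step (refl , NextMod⇒next j→j′)
  edge-step (rung₁ i→i′)      = U  , step (sym i→i′ , refl)
  edge-step (rung₂ i→i′ j′→j) = UL , step (sym i→i′ , sym (NextMod⇒next j′→j))

  neighbour-direction : ∀ {i j v} → Adj k (vmid i j) v → ∃ λ d → Target d i j v
  neighbour-direction (inj₁ e@(ring _))    = edge-step e
  neighbour-direction (inj₁ e@(rung₁ _))   = edge-step e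
  neighbour-direction (inj₁ e@(rung₂ _ _)) = edge-step e
  neighbour-direction (inj₂ e@(ring _))    = map neg Step-neg (edge-step e)
  neighbour-direction (inj₂ e@(rung₁ _))   = map neg Step-neg (edge-step e)
  neighbour-direction (inj₂ e@(rung₂ _ _)) = map neg Step-neg (edge-step e)
  neighbour-direction (inj₂ (bot i≡0))     = DR , refl , i≡0
  neighbour-direction (inj₂ (top i≡top))   = UL , refl , i≡top

  Target-functional : ∀ {d i j} v w → Target d i j v → Target d i j w → v ≡ w
  Target-functional v0          v0          _              _              = refl
  Target-functional vtop        vtop        _              _              = refl
  Target-functional v0          vtop        (refl , _)     (() , _)
  Target-functional vtop        v0          (refl , _)     (() , _)
  Target-functional v0          (vmid _ _)  (refl , i≡0)   s              = ⊥-elim (0≢1+n (trans (sym i≡0) (Step-rows s)))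
  Target-functional (vmid _ _)  v0          s              (refl , i≡0)   = ⊥-elim (0≢1+n (trans (sym i≡0) (Step-rows s)))
  Target-functional vtop        (vmid i′ _) (refl , i≡top) s              =
    ⊥-elim (<⇒≢ (toℕ<n i′) (trans (sym (Step-rows s)) i≡top))
  Target-functional (vmid i′ _) vtop        s              (refl , i≡top) =
    ⊥-elim (<⇒≢ (toℕ<n i′) (trans (sym (Step-rows s)) i≡top))
  Target-functional (vmid _ _)  (vmid _ _)  s              s′             = point-injective (Step-functional s s′)

  colour : Colouring k
  colour v0         (vmid i j)   = edgeColour DR (point i j)
  colour (vmid i j) v0           = edgeColour DR (point i j)
  colour vtop       (vmid i j)   = edgeColour UL (point i j)
  colour (vmid i j) vtop         = edgeColour UL (point i j)
  colour (vmid i j) (vmid i′ j′) = latticeColour (point i j) (point i′ j′)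
  colour _          _            = 0

  colour-Target : ∀ {d i j} v → Target d i j v → colour (vmid i j) v ≡ edgeColour d (point i j)
  colour-Target v0         (refl , _) = refl
  colour-Target vtop       (refl , _) = refl
  colour-Target (vmid _ _) s          = latticeColour-Step s

  edge-symmetric : ∀ {u v} → E k u v → colour u v ≡ colour v u
  edge-symmetric e@(ring _)    = latticeColour-symmetric (proj₂ (edge-step e))
  edge-symmetric e@(rung₁ _)   = latticeColour-symmetric (proj₂ (edge-step e))
  edge-symmetric e@(rung₂ _ _) = latticeColour-symmetric (proj₂ (edge-step e))
  edge-symmetric (bot _)       = refl
  edge-symmetric (top _)       = refl

  colour-symmetric : Symmetric k colour
  colour-symmetric (inj₁ e) = edge-symmetric e
  colour-symmetric (inj₂ e) = sym (edge-symmetric e)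

  colour-Target-reversed : ∀ {d i j v} → Adj k v (vmid i j) → Target d i j v →
    colour v (vmid i j) ≡ edgeColour d (point i j)
  colour-Target-reversed adj t = trans (colour-symmetric adj) (colour-Target _ t)

  colour-proper : Proper k colour
  colour-proper {v0} (inj₂ ()) _
  colour-proper {v0} _ (inj₂ ())
  colour-proper {v0} (inj₁ (bot i≡0)) (inj₁ (bot i′≡0)) v≢w same =
    v≢w (cong₂ vmid (toℕ-injective (trans i≡0 (sym i′≡0))) (next-injective (toℕ-injective same)))
  colour-proper {vtop} (inj₂ ()) _
  colour-proper {vtop} _ (inj₂ ())
  colour-proper {vtop} (inj₁ (top i≡top)) (inj₁ (top i′≡top)) v≢w same =
    v≢w (cong₂ vmid (toℕ-injective (suc-injective (trans i≡top (sym i′≡top)))) (toℕ-injective same))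
  colour-proper {vmid i j} {v} {w} uv uw v≢w same with neighbour-direction uv | neighbour-direction uw
  ... | d , t | d′ , t′
    with edgeColour-injective {d} {d′} (row-bound i) (trans (sym (colour-Target v t)) (trans same (colour-Target w t′)))
  ... | refl = v≢w (Target-functional v w t t′)

  record Square (a b c d : V k) : Set where
    constructor square
    field
      a≢c : a ≢ c
      b≢d : b ≢ d
      ab  : Adj k a b
      bc  : Adj k b c
      cd  : Adj k c d
      da  : Adj k d a

  Square-rotate : ∀ {a b c d} → Square a b c d → Square b c d a
  Square-rotate (square a≢c b≢d ab bc cd da) = square b≢d (≢-sym a≢c) bc cd da ab

  data OppositeMatch (a b c d : V k) : Set where
    first  : colour a b ≡ colour c d → OppositeMatch a b c d
    second : colour b c ≡ colour d a → OppositeMatch a b c d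

  by-rotation : ∀ {a b c d} → (Square b c d a → OppositeMatch b c d a) → Square a b c d → OppositeMatch a b c d
  by-rotation f sq with f (Square-rotate sq)
  ... | first e  = second e
  ... | second e = first (sym e)

  bottom-square : ∀ {b c d} → Square v0 b c d → OppositeMatch v0 b c d
  bottom-square (square _ _ (inj₂ ()) _ _ _)
  bottom-square (square _ _ _ _ _ (inj₁ ()))
  bottom-square {c = v0} (square a≢c _ _ _ _ _) = ⊥-elim (a≢c refl)
  bottom-square {c = vtop} (square _ _ (inj₁ (bot i≡0)) bc _ _) with neighbour-direction bc
  ... | _ , _ , i≡top = ⊥-elim (0≢1+n (suc-injective (trans (cong suc (sym i≡0)) i≡top)))
  bottom-square {c = vmid _ _} (square _ b≢d (inj₁ (bot ib≡0)) bc cd (inj₂ (bot id≡0)))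
    with neighbour-direction bc | neighbour-direction (swap cd)
  ... | _ , t₁ | _ , t₂ with bottom-corner ib≡0 id≡0 (apart b≢d) t₁ t₂
  ... | inj₁ e = first (trans e (sym (colour-Target-reversed cd t₂)))
  ... | inj₂ e = second (trans (colour-Target _ t₁) e)

  top-square : ∀ {b c d} → Square vtop b c d → OppositeMatch vtop b c d
  top-square (square _ _ (inj₂ ()) _ _ _)
  top-square (square _ _ _ _ _ (inj₁ ()))
  top-square {c = vtop} (square a≢c _ _ _ _ _) = ⊥-elim (a≢c refl)
  top-square {c = v0} (square _ _ (inj₁ (top i≡top)) bc _ _) with neighbour-direction bc
  ... | _ , _ , i≡0 = ⊥-elim (0≢1+n (trans (sym i≡0) (suc-injective i≡top)))
  top-square {c = vmid ic _} (square _ b≢d (inj₁ (top ib≡top)) bc cd (inj₂ (top id≡top)))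
    with neighbour-direction bc | neighbour-direction (swap cd)
  ... | _ , t₁ | _ , t₂
    with top-corner refl (≤-pred (toℕ<n ic)) (suc-injective ib≡top) (suc-injective id≡top) (apart b≢d) t₁ t₂
  ... | inj₁ e = first (trans e (sym (colour-Target-reversed cd t₂)))
  ... | inj₂ e = second (trans (colour-Target _ t₁) e)

  lattice-square : ∀ {ia ja ib jb ic jc id jd} → Square (vmid ia ja) (vmid ib jb) (vmid ic jc) (vmid id jd) →
    OppositeMatch (vmid ia ja) (vmid ib jb) (vmid ic jc) (vmid id jd)
  lattice-square (square a≢c b≢d ab bc cd da)
    with neighbour-direction ab | neighbour-direction bc | neighbour-direction (swap da) | neighbour-direction (swap cd)
  ... | _ , sx | _ , sy | _ , sx′ | _ , sy′ with square-colours (apart a≢c) (apart b≢d) sx sy sx′ sy′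
  ... | inj₁ e = first (trans (latticeColour-Step sx) (trans e (sym (colour-Target-reversed cd sy′))))
  ... | inj₂ e = second (trans (latticeColour-Step sy) (trans e (sym (colour-Target-reversed da sx′))))

  opposite-match : ∀ a b c d → Square a b c d → OppositeMatch a b c d
  opposite-match v0         _          _          _          = bottom-square
  opposite-match vtop       _          _          _          = top-square
  opposite-match (vmid _ _) v0         _          _          = by-rotation bottom-square
  opposite-match (vmid _ _) vtop       _          _          = by-rotation top-square
  opposite-match (vmid _ _) (vmid _ _) v0         _          = by-rotation (by-rotation bottom-square)
  opposite-match (vmid _ _) (vmid _ _) vtop       _          = by-rotation (by-rotation top-square)
  opposite-match (vmid _ _) (vmid _ _) (vmid _ _) v0         = by-rotation (by-rotation (by-rotation bottom-square))
  opposite-match (vmid _ _) (vmid _ _) (vmid _ _) vtop       = by-rotation (by-rotation (by-rotation top-square))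
  opposite-match (vmid _ _) (vmid _ _) (vmid _ _) (vmid _ _) = lattice-square

  no-rainbow : ¬ RainbowC4 k colour
  no-rainbow (a , b , c , d , _ , a≢c , _ , _ , b≢d , _ , ab , bc , cd , da , _ , ab≢cd , _ , _ , bc≢da , _)
    with opposite-match a b c d (square a≢c b≢d ab bc cd da)
  ... | first e  = ab≢cd e
  ... | second e = bc≢da e

mainTheorem4 : (k : ℕ) → 5 ≤ k →
    Σ (Colouring k) (λ c → Symmetric k c × Proper k c × ¬ RainbowC4 k c)
mainTheorem4 k 5≤k with m≤n⇒∃[o]m+o≡n 5≤k
... | n , refl = Hk.colour n , Hk.colour-symmetric n , Hk.colour-proper n , Hk.no-rainbow n
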